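{- Let $(\mathcal{C},\Omega,\mathfrak{P})$ be a measurable spined category. Then the triangulation functor $\Delta$ and the chordal triangulation functor $\Delta^{ch}$ of $(\mathcal{C},\Omega,\mathfrak{P})$ are both S-functors over $(\mathcal{C},\Omega,\mathfrak{P})$; that is, $\Delta(\Omega_n)=n=\Delta^{ch}(\Omega_n)$ for all $n\in\mathbb{N}$, and for every span $A \xleftarrow{a} \Omega_n \xrightarrow{b} B$ in $\mathcal{C}$ we have $\Delta(\mathfrak{P}(a,b))=\max\{\Delta(A),\Delta(B)\}$ and $\Delta^{ch}(\mathfrak{P}(a,b))=\max\{\Delta^{ch}(A),\Delta^{ch}(B)\}$.
   Context: $\mathbb{N}=\{0,1,2,\dots\}$. A spined category is a triple $(\mathcal{C},\Omega,\mathfrak{P})$ where $\mathcal{C}$ is a category, $\Omega=(\Omega_n)_{n\in\mathbb{N}}$ is a sequence of objects of $\mathcal{C}$ (the spine), and $\mathfrak{P}$ (the proxy pushout) assigns to each span $G\xleftarrow{g}\Omega_n\xrightarrow{h}H$ in $\mathcal{C}$ an object $\mathfrak{P}(g,h)$ together with morphisms $\mathfrak{P}(g,h)_g:G\to\mathfrak{P}(g,h)$ and $\mathfrak{P}(g,h)_h:H\to\mathfrak{P}(g,h)$ with $\mathfrak{P}(g,h)_g\circ g=\mathfrak{P}(g,h)_h\circ h$, such that (SC1) for every object $X$ there are $n\in\mathbb{N}$ and a morphism $X\to\Omega_n$; (SC2) for every such span and all morphisms $g':G\to G'$, $h':H\to H'$ there is a unique morphism $(g',h'):\mathfrak{P}(g,h)\to\mathfrak{P}(g'\circ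 g,h'\circ h)$ with $(g',h')\circ\mathfrak{P}(g,h)_g=\mathfrak{P}(g'g,h'h)_{g'g}\circ g'$ and $(g',h')\circ\mathfrak{P}(g,h)_h=\mathfrak{P}(g'g,h'h)_{h'h}\circ h'$. An S-functor over a spined category $(\mathcal{C},\Omega,\mathfrak{P})$ is a functor $F$ from $\mathcal{C}$ to the poset $(\mathbb{N},\le)$ (viewed as a category) such that $F(\Omega_n)=n$ for all $n$ and $F(\mathfrak{P}(g,h))=\max\{F(G),F(H)\}$ for every span $G\xleftarrow{g}\Omega_n\xrightarrow{h}H$ (i.e. a spine- and proxy-pushout-preserving functor to the spined category $(\mathbb{N}_\le, n\mapsto n, \max)$). The spined category is measurable if it admits at least one S-functor. An object $X$ is pseudo-chordal if $F(X)=G(X)$ for all S-functors $F,G$. The set of chordal objects is the smallest set $S$ of objects containing every $\Omega_n$ and containing $\mathfrak{P}(a,b)$ whenever $A,B\in S$ and $a:\Omega_n\to A$, $b:\Omega_n\to B$. A pseudo-chordal (resp. chordal) completion of $X$ is a morphism $\delta:X\to H$ with $H$ pseudo-chordal (resp. chordal); its width is $F(H)$ for any S-functor $F$ (independent of $F$). In a measurable spined category, $\Delta(X)$ (the triangulation functor) is the minimum width of a pseudo-chordal completion of $X$, and $\Delta^{ch}(X)$ (the chordal triangulation functor) is the minimum width of a chordal completion of $X$; on morphisms they act as the unique arrows of the poset $(\mathbb{N},\le)$. -}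

module Defs where

open import Level using (Level; _⊔_; suc)
open import Data.Nat using (ℕ; _≤_) renaming (_⊔_ to max)
open import Data.Product using (Σ; Σ-syntax; _×_; _,_; proj₁)
open import Relation.Binary.PropositionalEquality using (_≡_)

-- A (locally small, in the sense of Agda levels) category, morphism equality = _≡_.
record Category (o ℓ : Level) : Set (suc (o ⊔ ℓ)) where
  infixr 9 _∘_
  field
    Obj  : Set o
    Hom  : Obj → Obj → Set ℓ
    id   : ∀ {A} → Hom A A
    _∘_  : ∀ {A B C} → Hom B C → Hom A B → Hom A C
    assoc : ∀ {A B C D} (f : Hom A B) (g : Hom B C) (h : Hom C D) →
            (h ∘ g) ∘ f ≡ h ∘ (g ∘ f)
    identityˡ : ∀ {A B} (f : Hom A B) → id ∘ f ≡ f
    identityʳ : ∀ {A B} (f : Hom A B) → f ∘ id ≡ f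

record SpinedCategory (o ℓ : Level) : Set (suc (o ⊔ ℓ)) where
  field
    cat : Category o ℓ
  open Category cat public
  field
    Ω : ℕ → Obj
    𝔓   : ∀ {n G H} → Hom (Ω n) G → Hom (Ω n) H → Obj
    𝔓ˡ  : ∀ {n G H} (g : Hom (Ω n) G) (h : Hom (Ω n) H) → Hom G (𝔓 g h)
    𝔓ʳ  : ∀ {n G H} (g : Hom (Ω n) G) (h : Hom (Ω n) H) → Hom H (𝔓 g h)
    𝔓-comm : ∀ {n G H} (g : Hom (Ω n) G) (h : Hom (Ω n) H) →
             𝔓ˡ g h ∘ g ≡ 𝔓ʳ g h ∘ h
    SC1 : ∀ X → Σ[ n ∈ ℕ ] Hom X (Ω n)
    SC2-mor : ∀ {n G H G' H'} (g : Hom (Ω n) G) (h : Hom (Ω n) H)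
              (g' : Hom G G') (h' : Hom H H') →
              Hom (𝔓 g h) (𝔓 (g' ∘ g) (h' ∘ h))
    SC2-ˡ : ∀ {n G H G' H'} (g : Hom (Ω n) G) (h : Hom (Ω n) H)
            (g' : Hom G G') (h' : Hom H H') →
            SC2-mor g h g' h' ∘ 𝔓ˡ g h ≡ 𝔓ˡ (g' ∘ g) (h' ∘ h) ∘ g'
    SC2-ʳ : ∀ {n G H G' H'} (g : Hom (Ω n) G) (h : Hom (Ω n) H)
            (g' : Hom G G') (h' : Hom H H') →
            SC2-mor g h g' h' ∘ 𝔓ʳ g h ≡ 𝔓ʳ (g' ∘ g) (h' ∘ h) ∘ h'
    SC2-unique : ∀ {n G H G' H'} (g : Hom (Ω n) G) (h : Hom (Ω n) H)
                 (g' : Hom G G') (h' : Hom H H')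
                 (u : Hom (𝔓 g h) (𝔓 (g' ∘ g) (h' ∘ h))) →
                 u ∘ 𝔓ˡ g h ≡ 𝔓ˡ (g' ∘ g) (h' ∘ h) ∘ g' →
                 u ∘ 𝔓ʳ g h ≡ 𝔓ʳ (g' ∘ g) (h' ∘ h) ∘ h' →
                 u ≡ SC2-mor g h g' h'

module _ {o ℓ : Level} (SC : SpinedCategory o ℓ) where
  open SpinedCategory SC

  -- A functor into the poset (ℕ, ≤) is exactly a monotone object map
  -- (identity/composition laws are automatic since _≤_ is proof-irrelevant).
  record IsSFunctor (F : Obj → ℕ) : Set (o ⊔ ℓ) where
    field
      F-mono  : ∀ {X Y} → Hom X Y → F X ≤ F Y
      F-spine : ∀ n → F (Ω n) ≡ n
      F-𝔓     : ∀ {n G H} (g : Hom (Ω n) G) (h : Hom (Ω n) H) →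
                F (𝔓 g h) ≡ max (F G) (F H)

  SFunctor : Set (o ⊔ ℓ)
  SFunctor = Σ[ F ∈ (Obj → ℕ) ] IsSFunctor F

  -- measurable: admits at least one S-functor
  Measurable : Set (o ⊔ ℓ)
  Measurable = SFunctor

  PseudoChordal : Obj → Set (o ⊔ ℓ)
  PseudoChordal X = (F G : SFunctor) → proj₁ F X ≡ proj₁ G X

  data Chordal : Obj → Set (o ⊔ ℓ) where
    ch-Ω : ∀ n → Chordal (Ω n)
    ch-𝔓 : ∀ {n A B} (a : Hom (Ω n) A) (b : Hom (Ω n) B) →
           Chordal A → Chordal B → Chordal (𝔓 a b)

  -- Δ is the minimum width of a completion δ : X → H with H satisfying P,
  -- the width being measured by the S-functor F₀ (independent of the choice
  -- of S-functor for pseudo-chordal, in particular chordal, H).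
  IsMinCompletionWidth : (Obj → Set (o ⊔ ℓ)) → SFunctor → (Obj → ℕ) → Set (o ⊔ ℓ)
  IsMinCompletionWidth P (F₀ , _) Δ =
    ∀ X → (Σ[ H ∈ Obj ] Hom X H × P H × (F₀ H ≡ Δ X))
        × (∀ H → Hom X H → P H → Δ X ≤ F₀ H)

  IsTriangulationFunctor : SFunctor → (Obj → ℕ) → Set (o ⊔ ℓ)
  IsTriangulationFunctor = IsMinCompletionWidth PseudoChordal

  IsChordalTriangulationFunctor : SFunctor → (Obj → ℕ) → Set (o ⊔ ℓ)
  IsChordalTriangulationFunctor = IsMinCompletionWidth Chordal

-- Minimality of completion widths makes Δ monotone, and the identity completion
-- of Ω n together with monotonicity of the reference S-functor pins Δ (Ω n) to n.
-- For a proxy pushout 𝔓 g h, optimal completions δG, δH of G and H induce via (SC2)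
-- a completion 𝔓 g h → 𝔓 (δG ∘ g) (δH ∘ h), whose target is again (pseudo-)chordal
-- and has width max (Δ G) (Δ H); monotonicity gives the reverse inequality.
module Submission where

open import Defs
open import Level using (Level; _⊔_)
open import Data.Nat using (ℕ; _≤_) renaming (_⊔_ to max)
open import Data.Nat.Properties using (≤-antisym; ⊔-lub)
open import Data.Product using (_×_; _,_; proj₁; proj₂)
open import Relation.Binary.PropositionalEquality
  using (_≡_; sym; trans; cong₂; subst; subst₂)

module _ {o ℓ : Level} (SC : SpinedCategory o ℓ) where
  open SpinedCategory SC

  ContainsSpine : (Obj → Set (o ⊔ ℓ)) → Set (o ⊔ ℓ)
  ContainsSpine P = ∀ n → P (Ω n)

  ClosedUnder𝔓 : (Obj → Set (o ⊔ ℓ)) → Set (o ⊔ ℓ)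
  ClosedUnder𝔓 P = ∀ {n A B} (a : Hom (Ω n) A) (b : Hom (Ω n) B) →
                   P A → P B → P (𝔓 a b)

  pseudoChordal-Ω : ContainsSpine (PseudoChordal SC)
  pseudoChordal-Ω n (F , isF) (G , isG) =
    trans (IsSFunctor.F-spine isF n) (sym (IsSFunctor.F-spine isG n))

  pseudoChordal-𝔓 : ClosedUnder𝔓 (PseudoChordal SC)
  pseudoChordal-𝔓 a b pcA pcB F@(f , isF) G@(g , isG) =
    trans (IsSFunctor.F-𝔓 isF a b)
      (trans (cong₂ max (pcA F G) (pcB F G)) (sym (IsSFunctor.F-𝔓 isG a b)))

  module MinCompletionWidth
    (F₀ : SFunctor SC) {P : Obj → Set (o ⊔ ℓ)} {Δ : Obj → ℕ}
    (isMin : IsMinCompletionWidth SC P F₀ Δ) where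

    open IsSFunctor (proj₂ F₀)

    width : Obj → ℕ
    width = proj₁ F₀

    Δ-≤-width : ∀ {X H} → Hom X H → P H → Δ X ≤ width H
    Δ-≤-width {X} {H} = proj₂ (isMin X) H

    Δ-mono : ∀ {X Y} → Hom X Y → Δ X ≤ Δ Y
    Δ-mono {X} {Y} f with proj₁ (isMin Y)
    ... | H , δ , pH , width≡ = subst (Δ X ≤_) width≡ (Δ-≤-width (δ ∘ f) pH)

    Δ-spine : ContainsSpine P → ∀ n → Δ (Ω n) ≡ n
    Δ-spine pΩ n with proj₁ (isMin (Ω n))
    ... | H , δ , _ , width≡ = ≤-antisym upper lower
      where
      upper : Δ (Ω n) ≤ n
      upper = subst (Δ (Ω n) ≤_) (F-spine n) (Δ-≤-width id (pΩ n))

      lower : n ≤ Δ (Ω n)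
      lower = subst₂ _≤_ (F-spine n) width≡ (F-mono δ)

    Δ-𝔓 : ClosedUnder𝔓 P → ∀ {n G H} (g : Hom (Ω n) G) (h : Hom (Ω n) H) →
          Δ (𝔓 g h) ≡ max (Δ G) (Δ H)
    Δ-𝔓 p𝔓 {G = G} {H} g h with proj₁ (isMin G) | proj₁ (isMin H)
    ... | G' , δG , pG' , widthG≡ | H' , δH , pH' , widthH≡ =
      ≤-antisym upper (⊔-lub (Δ-mono (𝔓ˡ g h)) (Δ-mono (𝔓ʳ g h)))
      where
      upper : Δ (𝔓 g h) ≤ max (Δ G) (Δ H)
      upper = subst (Δ (𝔓 g h) ≤_)
        (trans (F-𝔓 (δG ∘ g) (δH ∘ h)) (cong₂ max widthG≡ widthH≡))
        (Δ-≤-width (SC2-mor g h δG δH) (p𝔓 (δG ∘ g) (δH ∘ h) pG' pH'))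

    Δ-isSFunctor : ContainsSpine P → ClosedUnder𝔓 P → IsSFunctor SC Δ
    Δ-isSFunctor pΩ p𝔓 = record
      { F-mono = Δ-mono ; F-spine = Δ-spine pΩ ; F-𝔓 = Δ-𝔓 p𝔓 }

theorem4p10 : ∀ {o ℓ : Level} (SC : SpinedCategory o ℓ) (m : Measurable SC)
    (Δ Δᶜʰ : SpinedCategory.Obj SC → ℕ) →
    IsTriangulationFunctor SC m Δ →
    IsChordalTriangulationFunctor SC m Δᶜʰ →
    IsSFunctor SC Δ × IsSFunctor SC Δᶜʰ
theorem4p10 SC m Δ Δᶜʰ isΔ isΔᶜʰ =
  MinCompletionWidth.Δ-isSFunctor SC m isΔ (pseudoChordal-Ω SC) (pseudoChordal-𝔓 SC) ,
  MinCompletionWidth.Δ-isSFunctor SC m isΔᶜʰ ch-Ω ch-𝔓
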